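{- Let $G$ be a $K_2$-hypohamiltonian graph containing a $4$-cycle $uvwx$ (with edges $uv,vw,wx,xu$). Then $u$ has at least two neighbours not in $N[w]$.
   Context: All graphs are finite, simple and connected. A graph is hamiltonian if it has a cycle through all its vertices. $G$ is $K_2$-hamiltonian if $G-y-z$ is hamiltonian for every pair of adjacent vertices $y,z$, and $K_2$-hypohamiltonian if moreover $G$ is not hamiltonian. $N[w]$ denotes the closed neighbourhood of $w$ (the set consisting of $w$ and its neighbours). -}

module Defs where

open import Data.Nat using (ℕ; _≤_)
open import Data.Fin using (Fin)
open import Data.List using (List; []; _∷_; length)
open import Data.List.Membership.Propositional using (_∈_)
open import Data.List.Relation.Unary.Unique.Propositional using (Unique)
open import Data.Product using (Σ; _×_; ∃)
open import Data.Sum using (_⊎_)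
open import Relation.Nullary using (¬_)
open import Relation.Binary.PropositionalEquality using (_≡_)

-- A finite simple graph on the vertex set Fin n: a symmetric, irreflexive
-- adjacency relation (decidability is not needed for the statement).
record Graph (n : ℕ) : Set₁ where
  field
    Adj     : Fin n → Fin n → Set
    sym     : ∀ {x y} → Adj x y → Adj y x
    irrefl  : ∀ {x} → ¬ Adj x x

open Graph public

data Path {n : ℕ} (G : Graph n) : List (Fin n) → Set where
  nil  : Path G []
  one  : ∀ x → Path G (x ∷ [])
  cons : ∀ x y xs → Adj G x y → Path G (y ∷ xs) → Path G (x ∷ y ∷ xs)

data LastAdj {n : ℕ} (G : Graph n) (x₀ : Fin n) : List (Fin n) → Set where
  lastAdj : ∀ x → Adj G x x₀ → LastAdj G x₀ (x ∷ [])
  step    : ∀ x y xs → LastAdj G x₀ (y ∷ xs) → LastAdj G x₀ (x ∷ y ∷ xs)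

record Cycle {n : ℕ} (G : Graph n) : Set where
  field
    x₀       : Fin n
    rest     : List (Fin n)
    unique   : Unique (x₀ ∷ rest)
    long     : 3 ≤ length (x₀ ∷ rest)
    path     : Path G (x₀ ∷ rest)
    closing  : LastAdj G x₀ (x₀ ∷ rest)

vertices : ∀ {n} {G : Graph n} → Cycle G → List (Fin n)
vertices c = Cycle.x₀ c ∷ Cycle.rest c

data LastEq {n : ℕ} (b : Fin n) : List (Fin n) → Set where
  here  : LastEq b (b ∷ [])
  there : ∀ x y xs → LastEq b (y ∷ xs) → LastEq b (x ∷ y ∷ xs)

Connected : ∀ {n} → Graph n → Set
Connected {n} G = ∀ (a b : Fin n) → Σ (List (Fin n)) λ xs →
  Σ (Path G (a ∷ xs)) λ _ → LastEq b (a ∷ xs)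

Hamiltonian : ∀ {n} → Graph n → Set
Hamiltonian {n} G = Σ (Cycle G) λ c → ∀ (v : Fin n) → v ∈ vertices c

-- G - y - z is hamiltonian: some cycle of G avoids y and z and passes
-- through every other vertex (a cycle of G avoiding y,z is exactly a cycle
-- of the induced subgraph G - y - z).
HamiltonianMinus : ∀ {n} → Graph n → Fin n → Fin n → Set
HamiltonianMinus {n} G y z = Σ (Cycle G) λ c →
  (¬ y ∈ vertices c) × (¬ z ∈ vertices c) ×
  (∀ (v : Fin n) → ¬ v ≡ y → ¬ v ≡ z → v ∈ vertices c)

K2-hamiltonian : ∀ {n} → Graph n → Set
K2-hamiltonian {n} G = ∀ (y z : Fin n) → Adj G y z → HamiltonianMinus G y z

K2-hypohamiltonian : ∀ {n} → Graph n → Set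
K2-hypohamiltonian G = K2-hamiltonian G × ¬ Hamiltonian G

InClosedNbhd : ∀ {n} → Graph n → Fin n → Fin n → Set
InClosedNbhd G w w' = w' ≡ w ⊎ Adj G w w'

-- Take a hamiltonian cycle C of G - w - x (it exists since wx is an edge) and
-- let a, b be the two neighbours of u on C. If w were adjacent to a, then
-- w x u … a w would be a hamiltonian cycle of G; if w were adjacent to b, then
-- u x w b … u would be one. So a and b are distinct neighbours of u outside N[w].
module Submission where

open import Defs
open import Data.Nat using (ℕ; _≤_; s≤s; z≤n)
open import Data.Fin using (Fin; _≟_)
open import Data.Product using (Σ; ∃; _×_; _,_)
open import Data.Sum using (inj₁; inj₂)
open import Data.List using ([]; _∷_; _++_; [_]; _∷ʳ_)
open import Data.List.Properties using (++-assoc; ∷-injective)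
open import Data.List.Membership.Propositional using (_∈_)
open import Data.List.Membership.Propositional.Properties using (∈-∃++)
open import Data.List.Relation.Unary.Any using (here; there)
open import Data.List.Relation.Unary.All using (_∷_; lookup)
open import Data.List.Relation.Unary.All.Properties using (¬Any⇒All¬)
open import Data.List.Relation.Unary.AllPairs using (_∷_)
open import Data.List.Relation.Binary.Permutation.Propositional
  using (_↭_; ↭⇒↭ₛ; ↭-sym; ↭-trans; ↭-refl)
open import Data.List.Relation.Binary.Permutation.Propositional.Properties
  using (∈-resp-↭; ↭-length; ∷↭∷ʳ)
open import Data.List.Relation.Binary.Permutation.Setoid.Properties using (Unique-resp-↭)
open import Relation.Nullary using (¬_; yes; no)
open import Relation.Binary.PropositionalEquality
  using (_≡_; refl; trans; cong₂; subst; setoid; module ≡-Reasoning)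
  renaming (sym to ≡-sym)

module _ {n : ℕ} {G : Graph n} where

  LastAdj⇒LastEq : ∀ {x₀ xs} → LastAdj G x₀ xs → ∃ λ ℓ → LastEq ℓ xs × Adj G ℓ x₀
  LastAdj⇒LastEq (lastAdj x e) = x , here , e
  LastAdj⇒LastEq (step x y xs l) with ℓ , ℓ-last , e ← LastAdj⇒LastEq l =
    ℓ , there x y xs ℓ-last , e

  LastEq⇒LastAdj : ∀ {ℓ x₀ xs} → LastEq ℓ xs → Adj G ℓ x₀ → LastAdj G x₀ xs
  LastEq⇒LastAdj here e = lastAdj _ e
  LastEq⇒LastAdj (there x y xs ℓ-last) e = step x y xs (LastEq⇒LastAdj ℓ-last e)

  LastEq⇒∈ : ∀ {ℓ : Fin n} {xs} → LastEq ℓ xs → ℓ ∈ xs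
  LastEq⇒∈ here = here refl
  LastEq⇒∈ (there _ _ _ ℓ-last) = there (LastEq⇒∈ ℓ-last)

  LastEq-∷ʳ : ∀ {y : Fin n} xs → LastEq y (xs ∷ʳ y)
  LastEq-∷ʳ [] = here
  LastEq-∷ʳ (x ∷ []) = there x _ [] here
  LastEq-∷ʳ (x ∷ x′ ∷ xs) = there x x′ _ (LastEq-∷ʳ (x′ ∷ xs))

  Path-∷ʳ : ∀ {ℓ y xs} → Path G xs → LastEq ℓ xs → Adj G ℓ y → Path G (xs ∷ʳ y)
  Path-∷ʳ (one x) here e = cons x _ [] e (one _)
  Path-∷ʳ (cons x x′ xs e′ p) (there _ _ _ ℓ-last) e = cons x x′ _ e′ (Path-∷ʳ p ℓ-last e)

  rotate : Cycle G → Cycle G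
  rotate record { rest = [] ; long = s≤s () }
  rotate c@record { x₀ = x₀ ; rest = y ∷ ys ; path = cons _ _ _ x₀y p ; closing = step _ _ _ l }
    with ℓ , ℓ-last , ℓx₀ ← LastAdj⇒LastEq l = record
    { x₀      = y
    ; rest    = ys ∷ʳ x₀
    ; unique  = Unique-resp-↭ (setoid _) (↭⇒↭ₛ x₀∷↭∷ʳx₀) (Cycle.unique c)
    ; long    = subst (3 ≤_) (↭-length x₀∷↭∷ʳx₀) (Cycle.long c)
    ; path    = Path-∷ʳ p ℓ-last ℓx₀
    ; closing = LastEq⇒LastAdj (LastEq-∷ʳ (y ∷ ys)) x₀y
    }
    where
    x₀∷↭∷ʳx₀ : x₀ ∷ y ∷ ys ↭ (y ∷ ys) ∷ʳ x₀
    x₀∷↭∷ʳx₀ = ∷↭∷ʳ x₀ (y ∷ ys)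

  vertices-rotate : (c : Cycle G) → vertices (rotate c) ≡ Cycle.rest c ∷ʳ Cycle.x₀ c
  vertices-rotate record { rest = [] ; long = s≤s () }
  vertices-rotate record { rest = _ ∷ _ ; path = cons _ _ _ _ _ ; closing = step _ _ _ _ } = refl

  rotate-↭ : (c : Cycle G) → vertices (rotate c) ↭ vertices c
  rotate-↭ c = subst (_↭ vertices c) (≡-sym (vertices-rotate c))
    (↭-sym (∷↭∷ʳ (Cycle.x₀ c) (Cycle.rest c)))

  vertices-rotate-∷ : ∀ {a A} (c : Cycle G) → vertices c ≡ a ∷ A → vertices (rotate c) ≡ A ∷ʳ a
  vertices-rotate-∷ {a} {A} c c≡a∷A with x₀≡a , rest≡A ← ∷-injective c≡a∷A = begin
    vertices (rotate c)         ≡⟨ vertices-rotate c ⟩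
    Cycle.rest c ∷ʳ Cycle.x₀ c  ≡⟨ cong₂ _∷ʳ_ rest≡A x₀≡a ⟩
    A ∷ʳ a                      ∎
    where open ≡-Reasoning

  rotateTo : ∀ {u} (c : Cycle G) → u ∈ vertices c →
    Σ (Cycle G) λ c′ → Cycle.x₀ c′ ≡ u × vertices c′ ↭ vertices c
  rotateTo {u} c u∈c with A , B , c≡A++u∷B ← ∈-∃++ u∈c = rotatePast A c c≡A++u∷B
    where
    rotatePast : ∀ A {B} (c : Cycle G) → vertices c ≡ A ++ u ∷ B →
      Σ (Cycle G) λ c′ → Cycle.x₀ c′ ≡ u × vertices c′ ↭ vertices c
    rotatePast [] c c≡u∷B with u≡x₀ , _ ← ∷-injective c≡u∷B = c , u≡x₀ , ↭-refl
    rotatePast (a ∷ A) {B} c c≡a∷A++u∷B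
      with c′ , x₀′≡u , c′↭ ← rotatePast A (rotate c)
             (trans (vertices-rotate-∷ c c≡a∷A++u∷B) (++-assoc A (u ∷ B) [ a ])) =
      c′ , x₀′≡u , ↭-trans c′↭ (rotate-↭ c)

  record Spans (c : Cycle G) (y z : Fin n) : Set where
    constructor spans
    field
      y∉ : ¬ y ∈ vertices c
      z∉ : ¬ z ∈ vertices c
      covers : ∀ v → ¬ v ≡ y → ¬ v ≡ z → v ∈ vertices c

  Spans-sym : ∀ {c y z} → Spans c y z → Spans c z y
  Spans-sym (spans y∉c z∉c covers) = spans z∉c y∉c λ v v≢z v≢y → covers v v≢y v≢z

  Spans-resp-↭ : ∀ {c c′ y z} → vertices c′ ↭ vertices c → Spans c y z → Spans c′ y z
  Spans-resp-↭ c′↭c (spans y∉c z∉c covers) = spans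
    (λ y∈c′ → y∉c (∈-resp-↭ c′↭c y∈c′))
    (λ z∈c′ → z∉c (∈-resp-↭ c′↭c z∈c′))
    (λ v v≢y v≢z → ∈-resp-↭ (↭-sym c′↭c) (covers v v≢y v≢z))

  insert₂ : ∀ {ℓ y z} (c : Cycle G) → LastEq ℓ (vertices c) → ¬ y ∈ vertices c → ¬ z ∈ vertices c →
    Adj G ℓ y → Adj G y z → Adj G z (Cycle.x₀ c) → Cycle G
  insert₂ {y = y} {z} c ℓ-last y∉c z∉c ℓy yz zx₀ = record
    { x₀      = y
    ; rest    = z ∷ vertices c
    ; unique  = (y≢z ∷ ¬Any⇒All¬ _ y∉c) ∷ ¬Any⇒All¬ _ z∉c ∷ Cycle.unique c
    ; long    = s≤s (s≤s (s≤s z≤n))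
    ; path    = cons y z _ yz (cons z _ _ zx₀ (Cycle.path c))
    ; closing = step y z _ (step z _ _ (LastEq⇒LastAdj ℓ-last ℓy))
    }
    where
    y≢z : ¬ y ≡ z
    y≢z refl = Graph.irrefl G yz

  Spans⇒Hamiltonian : ∀ {ℓ y z} (c : Cycle G) → Spans c y z → LastEq ℓ (vertices c) →
    Adj G ℓ y → Adj G y z → Adj G z (Cycle.x₀ c) → Hamiltonian G
  Spans⇒Hamiltonian {y = y} {z} c (spans y∉c z∉c covers) ℓ-last ℓy yz zx₀ =
    insert₂ c ℓ-last y∉c z∉c ℓy yz zx₀ , covers′
    where
    covers′ : ∀ v → v ∈ y ∷ z ∷ vertices c
    covers′ v with v ≟ y | v ≟ z
    ... | yes v≡y | _       = here v≡y
    ... | no _    | yes v≡z = there (here v≡z)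
    ... | no v≢y  | no v≢z  = there (there (covers v v≢y v≢z))

  Spans∧∈⇒≢ : ∀ {c y z v} → Spans c y z → v ∈ vertices c → ¬ v ≡ y
  Spans∧∈⇒≢ c-spans v∈c refl = Spans.y∉ c-spans v∈c

  head-neighbours-∉N[w] : ∀ {w x} → ¬ Hamiltonian G → Adj G w x →
    (c : Cycle G) → Spans c w x → Adj G x (Cycle.x₀ c) →
    Σ (Fin n) λ a → Σ (Fin n) λ b →
      ¬ a ≡ b × Adj G (Cycle.x₀ c) a × Adj G (Cycle.x₀ c) b ×
      ¬ InClosedNbhd G w a × ¬ InClosedNbhd G w b
  head-neighbours-∉N[w] _ _ record { rest = [] ; long = s≤s () } _ _
  head-neighbours-∉N[w] _ _ record { rest = _ ∷ [] ; long = s≤s (s≤s ()) } _ _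
  head-neighbours-∉N[w] {w} ¬ham wx
      c@record { x₀ = u ; rest = b ∷ d ∷ D ; unique = _ ∷ b∉dD ∷ _ ; path = cons _ _ _ ub _
       ; closing = step _ _ _ _ }
      c-spans xu
    with a , there _ _ _ (there _ _ _ a-last-dD) , au ← LastAdj⇒LastEq (Cycle.closing c) =
    a , b , a≢b , Graph.sym G au , ub , a∉N[w] , b∉N[w]
    where
    a≢b : ¬ a ≡ b
    a≢b refl = lookup b∉dD (LastEq⇒∈ a-last-dD) refl

    a∉N[w] : ¬ InClosedNbhd G w a
    a∉N[w] (inj₁ a≡w) = Spans∧∈⇒≢ c-spans (there (there (LastEq⇒∈ a-last-dD))) a≡w
    a∉N[w] (inj₂ wa) = ¬ham (Spans⇒Hamiltonian c c-spans
      (there _ _ _ (there _ _ _ a-last-dD)) (Graph.sym G wa) wx xu)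

    b∉N[w] : ¬ InClosedNbhd G w b
    b∉N[w] (inj₁ b≡w) = Spans∧∈⇒≢ c-spans (there (here refl)) b≡w
    b∉N[w] (inj₂ wb) = ¬ham (Spans⇒Hamiltonian (rotate c)
      (Spans-sym (Spans-resp-↭ (rotate-↭ c) c-spans))
      (LastEq-∷ʳ (b ∷ d ∷ D)) (Graph.sym G xu) (Graph.sym G wx) wb)

lemma6 : ∀ {n : ℕ} (G : Graph n) → Connected G → K2-hypohamiltonian G →
    ∀ (u v w x : Fin n) →
    ¬ u ≡ v → ¬ u ≡ w → ¬ u ≡ x → ¬ v ≡ w → ¬ v ≡ x → ¬ w ≡ x →
    Adj G u v → Adj G v w → Adj G w x → Adj G x u →
    Σ (Fin n) λ a → Σ (Fin n) λ b →
      ¬ a ≡ b × Adj G u a × Adj G u b ×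
      ¬ InClosedNbhd G w a × ¬ InClosedNbhd G w b
lemma6 G _ (k2-ham , ¬ham) u _ w x _ u≢w u≢x _ _ _ _ _ wx xu
  with c , w∉c , x∉c , covers ← k2-ham w x wx
  with c′ , refl , c′↭c ← rotateTo c (covers u u≢w u≢x) =
  head-neighbours-∉N[w] ¬ham wx c′ (Spans-resp-↭ {c = c} c′↭c (spans w∉c x∉c covers)) xu
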